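{- Let $n\ge 1$, let $\Delta_{n-1}$ be the simplex on the vertex set $[n]=\{1,\ldots,n\}$, and let $\mu$ be a perfect Morse matching of $\Delta_{n-1}$. Then for each $k\in\{0,\ldots,n-1\}$ the set $T_k(\mu)$ is a $(k,n)$-tree.
   Context: The faces of $\Delta_{n-1}$ are all subsets of $[n]$, including the empty set (the unique $(-1)$-face); a $k$-face is a subset of size $k+1$. Its Hasse diagram is the graph on all these faces with an edge $\{f,g\}$ whenever $f\subset g$ and $|g|=|f|+1$ (i.e. the graph of the $n$-cube). A perfect Morse matching is a perfect matching $\mu$ of this graph that is acyclic: orienting every edge from the larger set to the smaller one, except edges of $\mu$ which are oriented from smaller to larger, yields a directed graph with no directed cycle. $T_k(\mu)$ is the set of $k$-faces that $\mu$ matches with a $(k-1)$-face. Let $\Delta_{n-1}^{\le k-1}$ be the set of all faces of dimension at most $k-1$ and $\Delta_{n-1}^{k}$ the set of $k$-faces. A $(k,n)$-tree is a subset $T\subseteq\Delta_{n-1}^k$ with $|T|=\binom{n-1}{k}$ such that the simplicial complex $\Delta(T)=\Delta_{n-1}^{\le k-1}\cup T$ satisfies $\tilde H_k(\Delta(T);\mathbb{Z})=0$ (reduced integral simplicial homology). -}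

module Defs where

open import Data.Bool using (Bool; true; false; if_then_else_; _∧_; _∨_)
open import Data.Nat using (ℕ; zero; suc; _≡ᵇ_; _<ᵇ_; _≤ᵇ_; _∸_)
open import Data.Nat.Combinatorics using (_C_)
open import Data.Fin using (Fin; toℕ)
open import Data.Fin.Subset using (Subset; _⊆_; ∣_∣; _∪_; ⁅_⁆; inside; outside)
open import Data.Integer using (ℤ; 0ℤ; 1ℤ; -_) renaming (_+_ to _+ℤ_; _*_ to _*ℤ_)
open import Data.List using (List; []; _∷_; map; filter; length; foldr; allFin; _++_)
open import Data.Vec using (Vec; []; _∷_; lookup)
open import Data.Product using (Σ; _×_; _,_)
open import Data.Sum using (_⊎_)
open import Relation.Binary.PropositionalEquality using (_≡_)
open import Relation.Nullary using (¬_)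
open import Relation.Binary.Construct.Closure.Transitive using (TransClosure)

-- A face of the simplex Δ_{n-1} on vertex set [n] = Fin n is a subset of Fin n
-- (including the empty face).  A face of dimension d has size d+1.
Face : ℕ → Set
Face n = Subset n

allFaces : (n : ℕ) → List (Face n)
allFaces zero = [] ∷ []
allFaces (suc n) = map (outside ∷_) (allFaces n) ++ map (inside ∷_) (allFaces n)

count : {n : ℕ} → (Face n → Bool) → ℕ
count {n} P = length (filter (λ f → Data.Bool._≟_ (P f) true) (allFaces n))

Covers : {n : ℕ} → Face n → Face n → Set
Covers f g = (f ⊆ g) × (∣ g ∣ ≡ suc ∣ f ∣)

IsPerfectMatching : {n : ℕ} → (Face n → Face n) → Set
IsPerfectMatching μ = (∀ f → μ (μ f) ≡ f) × (∀ f → Covers f (μ f) ⊎ Covers (μ f) f)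

-- directed edges of the modified Hasse diagram: matched edges go up,
-- all other edges go down
Step : {n : ℕ} → (Face n → Face n) → Face n → Face n → Set
Step μ x y = (Covers x y × μ x ≡ y) ⊎ (Covers y x × ¬ (μ y ≡ x))

IsAcyclic : {n : ℕ} → (Face n → Face n) → Set
IsAcyclic μ = ∀ f → ¬ TransClosure (Step μ) f f

IsPerfectMorseMatching : {n : ℕ} → (Face n → Face n) → Set
IsPerfectMorseMatching μ = IsPerfectMatching μ × IsAcyclic μ

-- T_k(μ): k-faces (size k+1) matched with a (k-1)-face (size k)
Tk : {n : ℕ} → (Face n → Face n) → ℕ → Face n → Bool
Tk μ k f = (∣ f ∣ ≡ᵇ suc k) ∧ (∣ μ f ∣ ≡ᵇ k)

-- Reduced simplicial chains with ℤ coefficients.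
-- A simplicial complex on [n] is a boolean predicate on faces.
-- A chain is a function Face n → ℤ (finitely supported automatically).

sumℤ : {A : Set} → (A → ℤ) → List A → ℤ
sumℤ g xs = foldr (λ x acc → g x +ℤ acc) 0ℤ xs

below : {n : ℕ} → Face n → Fin n → ℕ
below {n} f i = length (filter (λ j → Data.Bool._≟_ (lookup f j ∧ (toℕ j <ᵇ toℕ i)) true) (allFin n))

sign : ℕ → ℤ
sign zero = 1ℤ
sign (suc m) = - sign m

-- boundary: (∂c)(f) = Σ_{i ∉ f} (-1)^{#{j ∈ f, j < i}} c(f ∪ {i}),
-- i.e. the usual ∂[v_0,…,v_d] = Σ_p (-1)^p [v_0,…,v̂_p,…,v_d] (reduced:
-- vertices have boundary the empty face).
∂ : {n : ℕ} → (Face n → ℤ) → Face n → ℤ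
∂ {n} c f = sumℤ (λ i → if lookup f i then 0ℤ else (sign (below f i) *ℤ c (f ∪ ⁅ i ⁆))) (allFin n)

-- c is a chain of K in degree "size m" (dimension m-1)
IsChain : {n : ℕ} → (Face n → Bool) → ℕ → (Face n → ℤ) → Set
IsChain K m c = ∀ f → ¬ (c f ≡ 0ℤ) → (K f ≡ true) × (∣ f ∣ ≡ m)

-- reduced homology H̃_d(K; ℤ) vanishes (d = dimension, faces of size d+1):
-- every d-cycle is a boundary of a (d+1)-chain
ReducedHomologyVanishes : {n : ℕ} → (Face n → Bool) → ℕ → Set
ReducedHomologyVanishes {n} K d =
  (c : Face n → ℤ) → IsChain K (suc d) c → (∀ f → ∂ c f ≡ 0ℤ) →
  Σ (Face n → ℤ) λ b → IsChain K (suc (suc d)) b × (∀ f → ∂ b f ≡ c f)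

-- Δ(T) = Δ_{n-1}^{≤ k-1} ∪ T
ΔT : {n : ℕ} → ℕ → (Face n → Bool) → Face n → Bool
ΔT k T f = (∣ f ∣ ≤ᵇ k) ∨ T f

IsTree : (k n : ℕ) → (Face n → Bool) → Set
IsTree k n T =
  (∀ f → T f ≡ true → ∣ f ∣ ≡ suc k) ×
  (count T ≡ (n ∸ 1) C k) ×
  ReducedHomologyVanishes (ΔT k T) k

-- Let D k = |T_k(μ)|. A (k+1)-element face f is matched either down (f ∈ T_k(μ)) or up
-- (μ f ∈ T_(k+1)(μ)), and μ is a bijection, so C(n, k+1) = D k + D (k+1). The empty face is matched
-- up, so D 0 = 1, and Pascal's rule then forces D k = C(n-1, k).
--
-- Homology. Δ(T_k(μ)) has no (k+1)-faces, so it suffices that every k-cycle c supported on T_k(μ)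
-- vanishes. If c t ≠ 0 then t is matched down to its facet μ t, and the term ±c t of (∂c)(μ t) = 0
-- must cancel against some other coface t′ of μ t with c t′ ≠ 0. Then t′ → μ t → t is a path in the
-- modified Hasse diagram; iterating gives arbitrarily long backward paths through finitely many
-- faces, hence a directed cycle.

module Submission where

open import Defs
open import Data.Bool using (Bool; true; false; _∧_; not; if_then_else_)
open import Data.Bool.Properties
  using (T-≡; T-∧; T-∨; ∧-zeroʳ; ∧-idem; ∧-inverseʳ) renaming (_≟_ to _≟ᵇ_)
open import Data.Empty using (⊥-elim)
open import Data.Fin using (Fin; zero; suc; toℕ)
open import Data.Fin.Properties using (any?; pigeonhole; suc-injective) renaming (_≟_ to _≟ᶠ_)
open import Data.Fin.Subset using (Subset; _∈_; _∉_; _⊆_; _∪_; ⁅_⁆; ∣_∣)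
open import Data.Fin.Subset.Properties
  using (_∈?_; ⊆-antisym; p⊂q⇒∣p∣<∣q∣; p⊆q⇒∣p∣≤∣q∣; p⊆p∪q; x∈p∪q⁻; x∈p∪q⁺; x∈⁅x⁆; x∈⁅y⁆⇒x≡y;
         ∪-identityʳ; drop-not-there)
open import Data.Integer using (ℤ; 0ℤ) renaming (_+_ to _+ℤ_; _*_ to _*ℤ_; ∣_∣ to ∣_∣ℤ)
open import Data.Integer.Properties using (∣i∣≡0⇒i≡0; abs-*; ∣-i∣≡∣i∣; *-zeroʳ; +-identityˡ; +-identityʳ)
  renaming (_≟_ to _≟ℤ_)
open import Data.List using (List; []; _∷_; map; filter; length; _++_; tabulate; allFin)
open import Data.List.Properties using (filter-++; length-++; filter-≐)
open import Data.List.Membership.Propositional using () renaming (_∈_ to _∈ₗ_)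
open import Data.List.Membership.Propositional.Properties using (∈-map⁺; ∈-map⁻; ∈-++⁺ˡ; ∈-++⁺ʳ)
open import Data.List.Membership.Propositional.Properties.WithK using (unique∧set⇒bag)
open import Data.List.Membership.Setoid.Properties using (index-injective)
open import Data.List.Relation.Binary.BagAndSetEquality using (∼bag⇒↭)
open import Data.List.Relation.Binary.Permutation.Propositional using (_↭_)
open import Data.List.Relation.Binary.Permutation.Propositional.Properties using (filter-↭; ↭-length)
open import Data.List.Relation.Unary.Any using (here; index)
import Data.List.Relation.Unary.All as All
open import Data.List.Relation.Unary.Unique.Propositional using (Unique; []; _∷_)
import Data.List.Relation.Unary.Unique.Propositional.Properties as Unique
open import Data.Nat using (ℕ; zero; suc; _+_; _*_; _≡ᵇ_; _≤_; _<_; _≥_; s≤s)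
open import Data.Nat.Properties
  using (+-suc; +-comm; +-cancelˡ-≡; *-identityˡ; ≡ᵇ⇒≡; ≤ᵇ⇒≤; <⇒≱; ≤-reflexive; n<1+n; n≮n; m≢1+n+m)
open import Data.Nat.Combinatorics using (_C_; nCk+nC[k+1]≡[n+1]C[k+1])
open import Data.Product using (Σ; ∃; _×_; _,_; proj₁; proj₂)
open import Data.Sum using (_⊎_; inj₁; inj₂)
open import Data.Vec using ([]; _∷_; lookup; here)
open import Data.Vec.Properties using (∷-injectiveʳ; lookup⇒[]=; []=⇒lookup)
open import Function using (id; _∘_)
open import Function.Bundles using (mk⇔; Equivalence)
open import Relation.Binary.PropositionalEquality
  using (_≡_; _≢_; refl; sym; trans; cong; cong₂; subst; setoid; module ≡-Reasoning)
open import Relation.Binary.Construct.Closure.Transitive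
  using (TransClosure; [_]; _∷_) renaming (_++_ to _++⁺_)
open import Relation.Nullary using (¬_; yes; no; ¬?; _×-dec_)
open import Relation.Nullary.Decidable using (decidable-stable)

-- count P is countIn P (allFaces n) by definition.
countIn : {A : Set} → (A → Bool) → List A → ℕ
countIn P xs = length (filter (λ x → P x ≟ᵇ true) xs)

countIn-++ : {A : Set} (P : A → Bool) (xs ys : List A) →
             countIn P (xs ++ ys) ≡ countIn P xs + countIn P ys
countIn-++ P xs ys = trans (cong length (filter-++ _ xs ys)) (length-++ (filter _ xs))

countIn-map : {A B : Set} (P : B → Bool) (g : A → B) (xs : List A) →
              countIn P (map g xs) ≡ countIn (P ∘ g) xs
countIn-map P g [] = refl
countIn-map P g (x ∷ xs) with P (g x)
... | true = cong suc (countIn-map P g xs)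
... | false = countIn-map P g xs

countIn-↭ : {A : Set} (P : A → Bool) {xs ys : List A} → xs ↭ ys → countIn P xs ≡ countIn P ys
countIn-↭ P xs↭ys = ↭-length (filter-↭ _ xs↭ys)

countIn-cong : {A : Set} {P Q : A → Bool} → (∀ x → P x ≡ Q x) → (xs : List A) →
               countIn P xs ≡ countIn Q xs
countIn-cong P≗Q xs =
  cong length (filter-≐ _ _ ((λ {x} → trans (sym (P≗Q x))) , (λ {x} → trans (P≗Q x))) xs)

countIn-split : {A : Set} (P Q : A → Bool) (xs : List A) →
                countIn P xs ≡ countIn (λ x → P x ∧ Q x) xs + countIn (λ x → P x ∧ not (Q x)) xs
countIn-split P Q [] = refl
countIn-split P Q (x ∷ xs) with P x | Q x
... | false | _ = countIn-split P Q xs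
... | true | true = cong suc (countIn-split P Q xs)
... | true | false = trans (cong suc (countIn-split P Q xs)) (sym (+-suc _ _))

countIn-false : {A : Set} (xs : List A) → countIn (λ _ → false) xs ≡ 0
countIn-false [] = refl
countIn-false (x ∷ xs) = countIn-false xs

allFaces-complete : ∀ {n} (f : Face n) → f ∈ₗ allFaces n
allFaces-complete [] = here refl
allFaces-complete {suc n} (false ∷ f) = ∈-++⁺ˡ (∈-map⁺ (false ∷_) (allFaces-complete f))
allFaces-complete {suc n} (true ∷ f) =
  ∈-++⁺ʳ (map (false ∷_) (allFaces n)) (∈-map⁺ (true ∷_) (allFaces-complete f))

allFaces-unique : ∀ n → Unique (allFaces n)
allFaces-unique zero = All.[] ∷ []
allFaces-unique (suc n) =
  Unique.++⁺ (Unique.map⁺ ∷-injectiveʳ (allFaces-unique n)) (Unique.map⁺ ∷-injectiveʳ (allFaces-unique n))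
             disjoint
  where
  disjoint : ∀ {f} → ¬ (f ∈ₗ map (false ∷_) (allFaces n) × f ∈ₗ map (true ∷_) (allFaces n))
  disjoint (f∈ , f∈′) with ∈-map⁻ (false ∷_) f∈ | ∈-map⁻ (true ∷_) f∈′
  ... | _ , _ , refl | _ , _ , ()

map-allFaces-↭ : ∀ {n} (μ : Face n → Face n) → (∀ f → μ (μ f) ≡ f) → map μ (allFaces n) ↭ allFaces n
map-allFaces-↭ {n} μ inv =
  ∼bag⇒↭ (unique∧set⇒bag (Unique.map⁺ μ-injective (allFaces-unique n)) (allFaces-unique n) λ {f} →
    mk⇔ (λ _ → allFaces-complete f)
        (λ _ → subst (_∈ₗ map μ (allFaces n)) (inv f) (∈-map⁺ μ (allFaces-complete (μ f)))))
  where
  μ-injective : ∀ {f g} → μ f ≡ μ g → f ≡ g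
  μ-injective {f} {g} eq = trans (sym (inv f)) (trans (cong μ eq) (inv g))

count-∘-involution : ∀ {n} (μ : Face n → Face n) → (∀ f → μ (μ f) ≡ f) → (P : Face n → Bool) →
                     count (P ∘ μ) ≡ count P
count-∘-involution {n} μ inv P =
  trans (sym (countIn-map P μ (allFaces n))) (countIn-↭ P (map-allFaces-↭ μ inv))

count-size : ∀ n m → count {n} (λ f → ∣ f ∣ ≡ᵇ m) ≡ n C m
count-size zero zero = refl
count-size zero (suc m) = refl
count-size (suc n) m = begin
  countIn (λ f → ∣ f ∣ ≡ᵇ m) (map (false ∷_) (allFaces n) ++ map (true ∷_) (allFaces n))
    ≡⟨ countIn-++ _ (map (false ∷_) (allFaces n)) _ ⟩
  countIn _ (map (false ∷_) (allFaces n)) + countIn _ (map (true ∷_) (allFaces n))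
    ≡⟨ cong₂ _+_ (countIn-map _ (false ∷_) (allFaces n)) (countIn-map _ (true ∷_) (allFaces n)) ⟩
  count {n} (λ f → ∣ f ∣ ≡ᵇ m) + count {n} (λ f → suc ∣ f ∣ ≡ᵇ m)
    ≡⟨ pascal m ⟩
  suc n C m ∎
  where
  open ≡-Reasoning
  pascal : ∀ m → count {n} (λ f → ∣ f ∣ ≡ᵇ m) + count {n} (λ f → suc ∣ f ∣ ≡ᵇ m) ≡ suc n C m
  pascal zero = cong₂ _+_ (count-size n zero) (countIn-false (allFaces n))
  pascal (suc m) = trans (cong₂ _+_ (count-size n (suc m)) (count-size n m))
                         (trans (+-comm (n C suc m) (n C m)) (nCk+nC[k+1]≡[n+1]C[k+1] n m))

pascal-recurrence⇒≡C : ∀ N (D : ℕ → ℕ) → D 0 ≡ 1 → (∀ m → D m + D (suc m) ≡ suc N C suc m) →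
                       ∀ m → D m ≡ N C m
pascal-recurrence⇒≡C N D D0≡1 pascal zero = D0≡1
pascal-recurrence⇒≡C N D D0≡1 pascal (suc m) = +-cancelˡ-≡ (N C m) _ _ (begin
  N C m + D (suc m) ≡⟨ cong (_+ D (suc m)) (sym (pascal-recurrence⇒≡C N D D0≡1 pascal m)) ⟩
  D m + D (suc m)   ≡⟨ pascal m ⟩
  suc N C suc m     ≡⟨ sym (nCk+nC[k+1]≡[n+1]C[k+1] N m) ⟩
  N C m + N C suc m ∎)
  where open ≡-Reasoning

Adjacent : ℕ → ℕ → Set
Adjacent s r = r ≡ suc s ⊎ s ≡ suc r

matched-Adjacent : ∀ {n} {μ : Face n → Face n} → IsPerfectMatching μ → ∀ f → Adjacent ∣ f ∣ ∣ μ f ∣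
matched-Adjacent (_ , covers) f with covers f
... | inj₁ (_ , ∣μf∣≡) = inj₁ ∣μf∣≡
... | inj₂ (_ , ∣f∣≡) = inj₂ ∣f∣≡

Adjacent-0⇒up : ∀ {s r} → Adjacent s r → (r ≡ᵇ 1) ∧ (s ≡ᵇ 0) ≡ (s ≡ᵇ 0)
Adjacent-0⇒up {s} (inj₁ refl) = ∧-idem (s ≡ᵇ 0)
Adjacent-0⇒up {r = r} (inj₂ refl) = ∧-zeroʳ (r ≡ᵇ 1)

Adjacent-¬down⇒up : ∀ {s r} m → Adjacent s r →
                    (s ≡ᵇ suc m) ∧ not (r ≡ᵇ m) ≡ (r ≡ᵇ suc (suc m)) ∧ (s ≡ᵇ suc m)
Adjacent-¬down⇒up {s} m (inj₁ refl) = matched-up s m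
  where
  matched-up : ∀ s m → (s ≡ᵇ suc m) ∧ not (suc s ≡ᵇ m) ≡ (s ≡ᵇ suc m) ∧ (s ≡ᵇ suc m)
  matched-up zero m = refl
  matched-up (suc zero) zero = refl
  matched-up (suc (suc s)) zero = refl
  matched-up (suc s) (suc m) = matched-up s m
Adjacent-¬down⇒up {r = r} m (inj₂ refl) = trans (∧-inverseʳ (r ≡ᵇ m)) (sym (matched-down r m))
  where
  matched-down : ∀ r m → (r ≡ᵇ suc (suc m)) ∧ (r ≡ᵇ m) ≡ false
  matched-down zero m = refl
  matched-down (suc r) zero = ∧-zeroʳ (r ≡ᵇ suc zero)
  matched-down (suc r) (suc m) = matched-down r m

module _ {n} {μ : Face n → Face n} (matching : IsPerfectMatching μ) where

  private
    inv : ∀ f → μ (μ f) ≡ f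
    inv = proj₁ matching

  count-Tk-zero : count (Tk μ 0) ≡ 1
  count-Tk-zero = begin
    count (Tk μ 0)                ≡⟨ count-∘-involution μ inv (Tk μ 0) ⟨
    count (Tk μ 0 ∘ μ)            ≡⟨ countIn-cong empty-matched-up (allFaces n) ⟩
    count {n} (λ f → ∣ f ∣ ≡ᵇ 0)  ≡⟨ count-size n 0 ⟩
    1                             ∎
    where
    open ≡-Reasoning
    empty-matched-up : ∀ f → Tk μ 0 (μ f) ≡ (∣ f ∣ ≡ᵇ 0)
    empty-matched-up f rewrite inv f = Adjacent-0⇒up (matched-Adjacent matching f)

  count-Tk-pascal : ∀ m → count (Tk μ m) + count (Tk μ (suc m)) ≡ n C suc m
  count-Tk-pascal m = begin
    count (Tk μ m) + count (Tk μ (suc m))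
      ≡⟨ cong (count (Tk μ m) +_) (count-∘-involution μ inv (Tk μ (suc m))) ⟨
    count (Tk μ m) + count (Tk μ (suc m) ∘ μ)
      ≡⟨ cong (count (Tk μ m) +_) (countIn-cong not-matched-down (allFaces n)) ⟨
    count (Tk μ m) + count {n} (λ f → (∣ f ∣ ≡ᵇ suc m) ∧ not (∣ μ f ∣ ≡ᵇ m))
      ≡⟨ countIn-split (λ f → ∣ f ∣ ≡ᵇ suc m) (λ f → ∣ μ f ∣ ≡ᵇ m) (allFaces n) ⟨
    count {n} (λ f → ∣ f ∣ ≡ᵇ suc m)
      ≡⟨ count-size n (suc m) ⟩
    n C suc m ∎
    where
    open ≡-Reasoning
    not-matched-down : ∀ f → (∣ f ∣ ≡ᵇ suc m) ∧ not (∣ μ f ∣ ≡ᵇ m) ≡ Tk μ (suc m) (μ f)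
    not-matched-down f rewrite inv f = Adjacent-¬down⇒up m (matched-Adjacent matching f)

count-Tk : ∀ {n} {μ : Face (suc n) → Face (suc n)} → IsPerfectMatching μ → ∀ k → count (Tk μ k) ≡ n C k
count-Tk {n} {μ} matching =
  pascal-recurrence⇒≡C n (λ k → count (Tk μ k)) (count-Tk-zero matching) (count-Tk-pascal matching)

∣p∪⁅x⁆∣≡1+∣p∣ : ∀ {n} {p : Subset n} {x} → x ∉ p → ∣ p ∪ ⁅ x ⁆ ∣ ≡ suc ∣ p ∣
∣p∪⁅x⁆∣≡1+∣p∣ {p = true ∷ p} {zero} x∉p = ⊥-elim (x∉p here)
∣p∪⁅x⁆∣≡1+∣p∣ {p = false ∷ p} {zero} x∉p = cong (suc ∘ ∣_∣) (∪-identityʳ p)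
∣p∪⁅x⁆∣≡1+∣p∣ {p = true ∷ p} {suc x} x∉p = cong suc (∣p∪⁅x⁆∣≡1+∣p∣ (drop-not-there x∉p))
∣p∪⁅x⁆∣≡1+∣p∣ {p = false ∷ p} {suc x} x∉p = ∣p∪⁅x⁆∣≡1+∣p∣ (drop-not-there x∉p)

p⊆q∧∣q∣≤∣p∣⇒p≡q : ∀ {n} {p q : Subset n} → p ⊆ q → ∣ q ∣ ≤ ∣ p ∣ → p ≡ q
p⊆q∧∣q∣≤∣p∣⇒p≡q {p = p} p⊆q ∣q∣≤∣p∣ = ⊆-antisym p⊆q λ {x} x∈q →
  decidable-stable (x ∈? p) λ x∉p → <⇒≱ (p⊂q⇒∣p∣<∣q∣ (p⊆q , x , x∈q , x∉p)) ∣q∣≤∣p∣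

Covers-∪⁅⁆ : ∀ {n} {p : Subset n} {x} → x ∉ p → Covers p (p ∪ ⁅ x ⁆)
Covers-∪⁅⁆ {x = x} x∉p = p⊆p∪q ⁅ x ⁆ , ∣p∪⁅x⁆∣≡1+∣p∣ x∉p

Covers⇒≡∪⁅⁆ : ∀ {n} {p q : Subset n} → Covers p q → ∃ λ x → x ∉ p × p ∪ ⁅ x ⁆ ≡ q
Covers⇒≡∪⁅⁆ {p = p} {q} (p⊆q , ∣q∣≡1+∣p∣) with any? (λ x → x ∈? q ×-dec ¬? (x ∈? p))
... | yes (x , x∈q , x∉p) =
  x , x∉p , p⊆q∧∣q∣≤∣p∣⇒p≡q p∪⁅x⁆⊆q (≤-reflexive (trans ∣q∣≡1+∣p∣ (sym (∣p∪⁅x⁆∣≡1+∣p∣ x∉p))))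
  where
  p∪⁅x⁆⊆q : p ∪ ⁅ x ⁆ ⊆ q
  p∪⁅x⁆⊆q y∈ with x∈p∪q⁻ p ⁅ x ⁆ y∈
  ... | inj₁ y∈p = p⊆q y∈p
  ... | inj₂ y∈⁅x⁆ = subst (_∈ q) (sym (x∈⁅y⁆⇒x≡y x y∈⁅x⁆)) x∈q
... | no ∄x = ⊥-elim (n≮n ∣ p ∣ (subst (_≤ ∣ p ∣) ∣q∣≡1+∣p∣ (p⊆q⇒∣p∣≤∣q∣ q⊆p)))
  where
  q⊆p : q ⊆ p
  q⊆p {x} x∈q = decidable-stable (x ∈? p) λ x∉p → ∄x (x , x∈q , x∉p)

∪⁅⁆-injective : ∀ {n} {p : Subset n} {x y} → x ∉ p → p ∪ ⁅ x ⁆ ≡ p ∪ ⁅ y ⁆ → x ≡ y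
∪⁅⁆-injective {p = p} {x} {y} x∉p eq with x∈p∪q⁻ p ⁅ y ⁆ (subst (x ∈_) eq (x∈p∪q⁺ (inj₂ (x∈⁅x⁆ x))))
... | inj₁ x∈p = ⊥-elim (x∉p x∈p)
... | inj₂ x∈⁅y⁆ = x∈⁅y⁆⇒x≡y y x∈⁅y⁆

sumℤ-tabulate-zero : ∀ {A : Set} {n} (g : A → ℤ) (f : Fin n → A) → (∀ i → g (f i) ≡ 0ℤ) →
                     sumℤ g (tabulate f) ≡ 0ℤ
sumℤ-tabulate-zero {n = zero} g f zeros = refl
sumℤ-tabulate-zero {n = suc n} g f zeros =
  cong₂ _+ℤ_ (zeros zero) (sumℤ-tabulate-zero g (f ∘ suc) (zeros ∘ suc))

sumℤ-tabulate-single : ∀ {A : Set} {n} (g : A → ℤ) (f : Fin n → A) i₀ → (∀ i → i ≢ i₀ → g (f i) ≡ 0ℤ) →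
                       sumℤ g (tabulate f) ≡ g (f i₀)
sumℤ-tabulate-single g f zero zeros = trans
  (cong (g (f zero) +ℤ_) (sumℤ-tabulate-zero g (f ∘ suc) (λ i → zeros (suc i) λ ())))
  (+-identityʳ (g (f zero)))
sumℤ-tabulate-single g f (suc i₀) zeros = trans
  (cong₂ _+ℤ_ (zeros zero λ ())
               (sumℤ-tabulate-single g (f ∘ suc) i₀ λ i i≢i₀ → zeros (suc i) (i≢i₀ ∘ suc-injective)))
  (+-identityˡ _)

sumℤ-allFin≡0⇒another-nonzero : ∀ {n} (g : Fin n → ℤ) {i₀} → sumℤ g (allFin n) ≡ 0ℤ → g i₀ ≢ 0ℤ →
                                 ∃ λ i → i ≢ i₀ × g i ≢ 0ℤ
sumℤ-allFin≡0⇒another-nonzero {n} g {i₀} sum≡0 gi₀≢0 with any? (λ i → ¬? (i ≟ᶠ i₀) ×-dec ¬? (g i ≟ℤ 0ℤ))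
... | yes found = found
... | no none = ⊥-elim (gi₀≢0 (trans (sym (sumℤ-tabulate-single g id i₀ others)) sum≡0))
  where
  others : ∀ i → i ≢ i₀ → g i ≡ 0ℤ
  others i i≢i₀ = decidable-stable (g i ≟ℤ 0ℤ) λ gi≢0 → none (i , i≢i₀ , gi≢0)

∣sign∣≡1 : ∀ m → ∣ sign m ∣ℤ ≡ 1
∣sign∣≡1 zero = refl
∣sign∣≡1 (suc m) = trans (∣-i∣≡∣i∣ (sign m)) (∣sign∣≡1 m)

sign*i≡0⇒i≡0 : ∀ m i → sign m *ℤ i ≡ 0ℤ → i ≡ 0ℤ
sign*i≡0⇒i≡0 m i eq = ∣i∣≡0⇒i≡0 (begin
  ∣ i ∣ℤ                  ≡⟨ sym (*-identityˡ ∣ i ∣ℤ) ⟩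
  1 * ∣ i ∣ℤ              ≡⟨ cong (_* ∣ i ∣ℤ) (sym (∣sign∣≡1 m)) ⟩
  ∣ sign m ∣ℤ * ∣ i ∣ℤ     ≡⟨ sym (abs-* (sign m) i) ⟩
  ∣ sign m *ℤ i ∣ℤ        ≡⟨ cong ∣_∣ℤ eq ⟩
  0                       ∎)
  where open ≡-Reasoning

-- ∂ c s is sumℤ (∂-term c s) (allFin n) by definition.
∂-term : ∀ {n} → (Face n → ℤ) → Face n → Fin n → ℤ
∂-term c s i = if lookup s i then 0ℤ else (sign (below s i) *ℤ c (s ∪ ⁅ i ⁆))

∂-term-∉ : ∀ {n} (c : Face n → ℤ) {s i} → i ∉ s → ∂-term c s i ≡ sign (below s i) *ℤ c (s ∪ ⁅ i ⁆)
∂-term-∉ c {s} {i} i∉s with lookup s i in eq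
... | true = ⊥-elim (i∉s (lookup⇒[]= i s eq))
... | false = refl

∂-term≢0 : ∀ {n} (c : Face n → ℤ) {s i} → ∂-term c s i ≢ 0ℤ → i ∉ s × c (s ∪ ⁅ i ⁆) ≢ 0ℤ
∂-term≢0 c {s} {i} term≢0 with lookup s i in eq
... | true = ⊥-elim (term≢0 refl)
... | false = i∉s , c≢0
  where
  i∉s : i ∉ s
  i∉s i∈s with trans (sym eq) ([]=⇒lookup i∈s)
  ... | ()
  c≢0 : c (s ∪ ⁅ i ⁆) ≢ 0ℤ
  c≢0 c≡0 = term≢0 (trans (cong (sign (below s i) *ℤ_) c≡0) (*-zeroʳ (sign (below s i))))

∂≡0⇒another-coface : ∀ {n} (c : Face n → ℤ) {s t} → ∂ c s ≡ 0ℤ → Covers s t → c t ≢ 0ℤ →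
                      ∃ λ i → i ∉ s × s ∪ ⁅ i ⁆ ≢ t × c (s ∪ ⁅ i ⁆) ≢ 0ℤ
∂≡0⇒another-coface c {s} ∂c≡0 s⋖t ct≢0 with Covers⇒≡∪⁅⁆ s⋖t
... | i₀ , i₀∉s , refl with sumℤ-allFin≡0⇒another-nonzero (∂-term c s) ∂c≡0 term₀≢0
  where
  term₀≢0 : ∂-term c s i₀ ≢ 0ℤ
  term₀≢0 term₀≡0 = ct≢0 (sign*i≡0⇒i≡0 (below s i₀) _ (trans (sym (∂-term-∉ c i₀∉s)) term₀≡0))
... | i , i≢i₀ , term≢0 with ∂-term≢0 c term≢0
... | i∉s , c≢0 = i , i∉s , (λ eq → i≢i₀ (∪⁅⁆-injective i∉s eq)) , c≢0

module _ {A : Set} {_≺_ : A → A → Set} (P : A → Set)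
         (descend : ∀ {x} → P x → ∃ λ y → P y × TransClosure _≺_ y x) where

  private
    next : Σ A P → Σ A P
    next (x , px) = proj₁ (descend px) , proj₁ (proj₂ (descend px))

    chain : Σ A P → ℕ → A
    chain x₀ zero = proj₁ x₀
    chain x₀ (suc m) = chain (next x₀) m

    chain-from-start : ∀ x₀ m → TransClosure _≺_ (chain x₀ (suc m)) (proj₁ x₀)
    chain-from-start (x , px) zero = proj₂ (proj₂ (descend px))
    chain-from-start (x , px) (suc m) = chain-from-start (next (x , px)) m ++⁺ proj₂ (proj₂ (descend px))

    chain-path : ∀ x₀ {m m′} → m < m′ → TransClosure _≺_ (chain x₀ m′) (chain x₀ m)
    chain-path x₀ {zero} {suc m′} _ = chain-from-start x₀ m′
    chain-path x₀ {suc m} {suc m′} (s≤s m<m′) = chain-path (next x₀) m<m′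

  acyclic⇒no-infinite-descent : (xs : List A) → (∀ x → x ∈ₗ xs) → (∀ x → ¬ TransClosure _≺_ x x) →
                                ∀ {x} → ¬ P x
  acyclic⇒no-infinite-descent xs complete acyclic {x} px
    with pigeonhole (n<1+n (length xs)) (λ i → index (complete (chain (x , px) (toℕ i))))
  ... | i , j , i<j , same-index =
    acyclic _ (subst (λ y → TransClosure _≺_ y _) chain-j≡chain-i (chain-path (x , px) i<j))
    where
    chain-j≡chain-i : chain (x , px) (toℕ j) ≡ chain (x , px) (toℕ i)
    chain-j≡chain-i = index-injective (setoid A) (complete _) (complete _) (sym same-index)

module _ {n} {μ : Face n → Face n} (inv : ∀ f → μ (μ f) ≡ f) (acyclic : IsAcyclic μ) where

  matched-down-cycle≡0 : (c : Face n → ℤ) → (∀ t → c t ≢ 0ℤ → Covers (μ t) t) → (∀ s → ∂ c s ≡ 0ℤ) →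
                         ∀ t → c t ≡ 0ℤ
  matched-down-cycle≡0 c matched-down cycle t =
    decidable-stable (c t ≟ℤ 0ℤ)
      (acyclic⇒no-infinite-descent (λ t → c t ≢ 0ℤ) descend (allFaces n) allFaces-complete acyclic)
    where
    descend : ∀ {t} → c t ≢ 0ℤ → ∃ λ t′ → c t′ ≢ 0ℤ × TransClosure (Step μ) t′ t
    descend {t} ct≢0 with ∂≡0⇒another-coface c (cycle (μ t)) (matched-down t ct≢0) ct≢0
    ... | i , i∉μt , t′≢t , ct′≢0 =
      μ t ∪ ⁅ i ⁆ , ct′≢0 ,
      inj₂ (Covers-∪⁅⁆ i∉μt , λ t≡t′ → t′≢t (trans (sym t≡t′) (inv t)))
        ∷ [ inj₁ (matched-down t ct≢0 , inv t) ]

∂-zero : ∀ {n} (f : Face n) → ∂ (λ _ → 0ℤ) f ≡ 0ℤ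
∂-zero f = sumℤ-tabulate-zero _ id term≡0
  where
  term≡0 : ∀ i → ∂-term (λ _ → 0ℤ) f i ≡ 0ℤ
  term≡0 i with lookup f i
  ... | true = refl
  ... | false = *-zeroʳ (sign (below f i))

cycles≡0⇒H̃≡0 : ∀ {n} {K : Face n → Bool} {d} →
               (∀ c → IsChain K (suc d) c → (∀ f → ∂ c f ≡ 0ℤ) → ∀ f → c f ≡ 0ℤ) →
               ReducedHomologyVanishes K d
cycles≡0⇒H̃≡0 cycles≡0 c chain cycle =
  (λ _ → 0ℤ) , (λ f 0≢0 → ⊥-elim (0≢0 refl)) , λ f → trans (∂-zero f) (sym (cycles≡0 c chain cycle f))

Tk-sizes : ∀ {n} (μ : Face n → Face n) {k f} → Tk μ k f ≡ true → ∣ f ∣ ≡ suc k × ∣ μ f ∣ ≡ k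
Tk-sizes μ Tkf with Equivalence.to T-∧ (Equivalence.from T-≡ Tkf)
... | ∣f∣≡ , ∣μf∣≡ = ≡ᵇ⇒≡ _ _ ∣f∣≡ , ≡ᵇ⇒≡ _ _ ∣μf∣≡

Tk-matched-down : ∀ {n} {μ : Face n → Face n} → IsPerfectMatching μ →
                  ∀ k t → Tk μ k t ≡ true → Covers (μ t) t
Tk-matched-down {μ = μ} (_ , covers) k t Tkt with covers t | Tk-sizes μ Tkt
... | inj₂ μt⋖t | _ = μt⋖t
... | inj₁ (_ , ∣μt∣≡2+∣t∣) | ∣t∣≡1+k , ∣μt∣≡k =
  ⊥-elim (m≢1+n+m k (trans (sym ∣μt∣≡k) (trans ∣μt∣≡2+∣t∣ (cong suc ∣t∣≡1+k))))

ΔT-top : ∀ {n} k (T : Face n → Bool) f → ΔT k T f ≡ true → ∣ f ∣ ≡ suc k → T f ≡ true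
ΔT-top k T f f∈ΔT ∣f∣≡1+k with Equivalence.to T-∨ (Equivalence.from T-≡ f∈ΔT)
... | inj₁ ∣f∣≤k = ⊥-elim (n≮n k (subst (_≤ k) ∣f∣≡1+k (≤ᵇ⇒≤ _ _ ∣f∣≤k)))
... | inj₂ Tf = Equivalence.to T-≡ Tf

lemma10 : (n : ℕ) → n ≥ 1 → (μ : Face n → Face n) → IsPerfectMorseMatching μ →
          (k : ℕ) → k < n → IsTree k n (Tk μ k)
lemma10 (suc n) _ μ (matching , acyclic) k _ =
  (λ f → proj₁ ∘ Tk-sizes μ) , count-Tk matching k , cycles≡0⇒H̃≡0 cycles≡0
  where
  cycles≡0 : ∀ c → IsChain (ΔT k (Tk μ k)) (suc k) c → (∀ f → ∂ c f ≡ 0ℤ) → ∀ f → c f ≡ 0ℤ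
  cycles≡0 c chain = matched-down-cycle≡0 (proj₁ matching) acyclic c λ t ct≢0 →
    let (t∈ΔT , ∣t∣≡1+k) = chain t ct≢0
    in  Tk-matched-down matching k t (ΔT-top k (Tk μ k) t t∈ΔT ∣t∣≡1+k)
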